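{- Let $\mathcal{C}$ be a minimum-transversal-covered clutter on a finite set $E$ satisfying the integral blocking condition. Then every maximum fractional packing $y$ of $\mathcal{C}$ is supported on $\tilde{\mathcal{C}}$ and satisfies $\sum_{H\in\tilde{\mathcal{C}}}y(H)1_H=1_E$ and $\sum_{H\in\tilde{\mathcal{C}}}y(H)=\mathrm{bn}(\tilde{\mathcal{C}})=\mathrm{bn}(\mathcal{C})$. Moreover $\mathrm{F}(\mathcal{C})=\mathrm{F}(\tilde{\mathcal{C}})$, where a function on $\tilde{\mathcal{C}}$ is identified with its extension by zero to $\mathcal{C}$.
   Context: A clutter on $E$ is a family of subsets none containing another (members: hyperedges). A transversal is an inclusion-minimal subset meeting every hyperedge; $\mathrm{bn}(\mathcal{C})$ the minimum transversal size; $\mathrm{minb}(\mathcal{C})$ the minimum-size transversals; minimum-transversal-covered means $\bigcup\mathrm{minb}(\mathcal{C})=E$. A fractional packing is $y:\mathcal{C}\to\mathbb{R}_{\ge0}$ with $\sum_{H\ni a}y(H)\le1$ for all $a\in E$; a maximum fractional packing maximizes $\sum_Hy(H)$; $\mathrm{F}(\mathcal{C})$ is the set of maximum fractional packings and $\mathrm{fpn}(\mathcal{C})$ their value. Integral blocking condition: $\mathrm{fpn}(\mathcal{C})=\mathrm{bn}(\mathcal{C})$. $\tilde{\mathcal{C}}=\{H\in\mathcal{C}:|H\cap B|=1\ \forall B\in\mathrm{minb}(\mathcal{C})\}$. $1_S$ is the incidence vector of $S$.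
   Formalization: The fractional packings y, including those that define $\mathrm{fpn}(\mathcal{C})$, $\mathrm{F}(\mathcal{C})$ and $\mathrm{F}(\tilde{\mathcal{C}})$, take values in the nonnegative rationals rather than $\mathbb{R}_{\ge0}$. -}

module Defs where

open import Data.Nat using (ℕ; zero; suc)
open import Data.Fin using (Fin; zero; suc)
open import Data.Fin.Subset using (Subset; _∈_; _⊆_; _∩_; ∣_∣)
open import Data.Vec using (lookup)
open import Data.Bool using (if_then_else_)
open import Data.Integer using (+_)
open import Data.Rational using (ℚ; 0ℚ; 1ℚ; _+_; _≤_; _/_)
open import Data.Product using (Σ; ∃; ∃-syntax; _×_)
open import Data.Unit using (⊤)
open import Relation.Nullary using (¬_)
open import Relation.Binary.PropositionalEquality using (_≡_; _≢_)

Family : ℕ → ℕ → Set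
Family n m = Fin m → Subset n

IsClutter : ∀ {n m} → Family n m → Set
IsClutter {n} {m} C = (i j : Fin m) → i ≢ j → ¬ (C i ⊆ C j)

-- A sub-clutter of C is given by a predicate S on the indices (selected hyperedges).
-- The whole clutter C corresponds to S = λ _ → ⊤.
All : ∀ {m} → Fin m → Set
All _ = ⊤

Meets : ∀ {n} → Subset n → Subset n → Set
Meets {n} B H = ∃[ a ] (a ∈ B × a ∈ H)

IsCover : ∀ {n m} → (Fin m → Set) → Family n m → Subset n → Set
IsCover {n} {m} S C B = (i : Fin m) → S i → Meets B (C i)

IsTransversal : ∀ {n m} → (Fin m → Set) → Family n m → Subset n → Set
IsTransversal {n} S C B =
  IsCover S C B × ((B′ : Subset n) → B′ ⊆ B → IsCover S C B′ → B ⊆ B′)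

IsMinTransversal : ∀ {n m} → (Fin m → Set) → Family n m → Subset n → Set
IsMinTransversal {n} S C B =
  IsTransversal S C B × ((B′ : Subset n) → IsTransversal S C B′ → ∣ B ∣ Data.Nat.≤ ∣ B′ ∣)

IsBn : ∀ {n m} → (Fin m → Set) → Family n m → ℕ → Set
IsBn {n} S C k =
  (∃[ B ] (IsTransversal S C B × ∣ B ∣ ≡ k)) ×
  ((B : Subset n) → IsTransversal S C B → k Data.Nat.≤ ∣ B ∣)

IsMinTransversalCovered : ∀ {n m} → Family n m → Set
IsMinTransversalCovered {n} C = (a : Fin n) → ∃[ B ] (IsMinTransversal All C B × a ∈ B)

sumFin : ∀ {m} → (Fin m → ℚ) → ℚ
sumFin {zero} f = 0ℚ
sumFin {suc m} f = f zero + sumFin (λ i → f (suc i))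

-- Σ_{H ∋ a} y(H)  =  (Σ_H y(H) 1_H)(a)
load : ∀ {n m} → Family n m → (Fin m → ℚ) → Fin n → ℚ
load C y a = sumFin (λ i → if lookup (C i) a then y i else 0ℚ)

value : ∀ {m} → (Fin m → ℚ) → ℚ
value y = sumFin y

-- fractional packing of the sub-clutter selected by S, as a function on all of C
-- extended by zero outside S
IsPacking : ∀ {n m} → (Fin m → Set) → Family n m → (Fin m → ℚ) → Set
IsPacking {n} {m} S C y =
  ((i : Fin m) → 0ℚ ≤ y i) ×
  ((i : Fin m) → ¬ S i → y i ≡ 0ℚ) ×
  ((a : Fin n) → load C y a ≤ 1ℚ)

IsMaxPacking : ∀ {n m} → (Fin m → Set) → Family n m → (Fin m → ℚ) → Set
IsMaxPacking {m = m} S C y =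
  IsPacking S C y × ((y′ : Fin m → ℚ) → IsPacking S C y′ → value y′ ≤ value y)

ℕtoℚ : ℕ → ℚ
ℕtoℚ k = + k / 1

IntegralBlocking : ∀ {n m} → Family n m → Set
IntegralBlocking {m = m} C =
  ∃[ k ] (IsBn All C k × ∃[ y ] (IsMaxPacking All C y × value y ≡ ℕtoℚ k))

InTilde : ∀ {n m} → Family n m → Fin m → Set
InTilde {n} C i = (B : Subset n) → IsMinTransversal All C B → ∣ C i ∩ B ∣ ≡ 1

{-# OPTIONS --safe #-}
-- For a maximum packing y and a minimum transversal B,
--   bn = Σ_H y(H) ≤ Σ_H y(H) |H ∩ B| = Σ_{a ∈ B} load(a) ≤ |B| = bn,
-- so both inequalities are tight: a hyperedge in the support of y meets
-- every minimum transversal exactly once, and the load is 1 on every minimum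
-- transversal, hence on all of E.  The same chain for an arbitrary cover of
-- C̃ (which meets the support of y) gives bn(C̃) ≥ bn, and a minimum
-- transversal of C covers C̃.
module Submission where

open import Defs
open import Data.Nat using (ℕ)
open import Data.Fin using (Fin)
open import Data.Rational using (ℚ; 1ℚ; 0ℚ)
open import Data.Product using (∃-syntax; _×_)
open import Relation.Nullary using (¬_)
open import Relation.Binary.PropositionalEquality using (_≡_)
open import Function.Bundles using (_⇔_)

open import Data.Nat as ℕ using (zero; suc)
open import Data.Fin using (zero; suc)
import Data.Nat.Properties as ℕ
import Data.Nat.Coprimality as Coprime
import Data.Integer as ℤ
import Data.Integer.Properties as ℤ
open import Data.Rational using (_+_; _*_; _≤_; _/_; mkℚ; *≤*; nonNegative; ≢-nonZero)
import Data.Rational.Properties as ℚ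
open import Algebra.Properties.CommutativeMonoid.Sum ℚ.+-0-commutativeMonoid
  using (sum; sum-cong-≗; sum-replicate-zero; ∑-comm)
open import Data.Bool using (true; false; if_then_else_; _∧_)
open import Data.Vec using ([]; _∷_; lookup; here)
open import Data.Vec.Properties using ([]=⇒lookup; lookup-zipWith)
open import Data.Fin.Subset using (Subset; _∈_; _⊆_; _∩_; ∣_∣; ⁅_⁆; inside; outside)
open import Data.Fin.Subset.Properties
  using (drop-∷-⊆; out⊆; in⊆in; p⊆q⇒∣p∣≤∣q∣; x∈p∩q⁺; x∈⁅y⁆⇒x≡y; ∣⁅x⁆∣≡1)
open import Data.Product using (_,_; proj₁; proj₂)
open import Data.Unit using (tt)
open import Data.Empty using (⊥-elim)
open import Function using (_∘_; flip)
open import Function.Bundles using (mk⇔)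
open import Relation.Nullary.Decidable using (yes; no; decidable-stable)
open import Relation.Binary.PropositionalEquality
  using (_≢_; refl; sym; trans; cong; subst; subst₂; module ≡-Reasoning)

ℕtoℚ≡mkℚ : ∀ k → ℕtoℚ k ≡ mkℚ (ℤ.+ k) 0 (Coprime.sym (Coprime.1-coprimeTo k))
ℕtoℚ≡mkℚ k = ℚ.normalize-coprime (Coprime.sym (Coprime.1-coprimeTo k))

-- Once ℕtoℚ k is in mkℚ form the sum computes; only the numerator k * 1 is stuck.
ℕtoℚ-suc : ∀ k → ℕtoℚ (suc k) ≡ 1ℚ + ℕtoℚ k
ℕtoℚ-suc k rewrite ℕtoℚ≡mkℚ k = cong (λ z → (ℤ.+ 1 ℤ.+ z) / 1) (sym (ℤ.*-identityʳ (ℤ.+ k)))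

ℕtoℚ-mono-≤ : ∀ {j k} → j ℕ.≤ k → ℕtoℚ j ≤ ℕtoℚ k
ℕtoℚ-mono-≤ {j} {k} j≤k rewrite ℕtoℚ≡mkℚ j | ℕtoℚ≡mkℚ k =
  *≤* (subst₂ ℤ._≤_ (sym (ℤ.*-identityʳ (ℤ.+ j))) (sym (ℤ.*-identityʳ (ℤ.+ k))) (ℤ.+≤+ j≤k))

ℕtoℚ-cancel-≤ : ∀ {j k} → ℕtoℚ j ≤ ℕtoℚ k → j ℕ.≤ k
ℕtoℚ-cancel-≤ {j} {k} le rewrite ℕtoℚ≡mkℚ j | ℕtoℚ≡mkℚ k with le
... | *≤* p = ℤ.drop‿+≤+ (subst₂ ℤ._≤_ (ℤ.*-identityʳ (ℤ.+ j)) (ℤ.*-identityʳ (ℤ.+ k)) p)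

p≡p*c⇒c≡1 : ∀ {p c} → 0ℚ ≤ p → p ≢ 0ℚ → p ≡ p * ℕtoℚ c → c ≡ 1
p≡p*c⇒c≡1 {p} {c} 0≤p p≢0 p≡p*c =
  ℕ.≤-antisym (ℕtoℚ-cancel-≤ (ℚ.*-cancelˡ-≤-pos p (ℚ.≤-reflexive (sym p*1≡p*c))))
              (ℕtoℚ-cancel-≤ (ℚ.*-cancelˡ-≤-pos p (ℚ.≤-reflexive p*1≡p*c)))
  where
  instance
    _ = ℚ.nonNeg∧nonZero⇒pos p {{nonNegative 0≤p}} {{≢-nonZero p≢0}}
  p*1≡p*c : p * 1ℚ ≡ p * ℕtoℚ c
  p*1≡p*c = trans (ℚ.*-identityʳ p) p≡p*c

+-mono-≤-equality : ∀ {p q r s} → p ≤ q → r ≤ s → q + s ≤ p + r → p ≡ q × r ≡ s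
+-mono-≤-equality p≤q r≤s q+s≤p+r =
    ℚ.≤-antisym p≤q (ℚ.≮⇒≥ λ p<q → ℚ.<-irrefl refl (ℚ.<-≤-trans (ℚ.+-mono-<-≤ p<q r≤s) q+s≤p+r))
  , ℚ.≤-antisym r≤s (ℚ.≮⇒≥ λ r<s → ℚ.<-irrefl refl (ℚ.<-≤-trans (ℚ.+-mono-≤-< p≤q r<s) q+s≤p+r))

sumFin≡sum : ∀ {m} (f : Fin m → ℚ) → sumFin f ≡ sum f
sumFin≡sum {zero}  f = refl
sumFin≡sum {suc m} f = cong (f zero +_) (sumFin≡sum (f ∘ suc))

sumFin-cong : ∀ {m} {f g : Fin m → ℚ} → (∀ i → f i ≡ g i) → sumFin f ≡ sumFin g
sumFin-cong {f = f} {g} f≗g = trans (sumFin≡sum f) (trans (sum-cong-≗ f≗g) (sym (sumFin≡sum g)))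

sumFin-zero : ∀ m → sumFin {m} (λ _ → 0ℚ) ≡ 0ℚ
sumFin-zero m = trans (sumFin≡sum {m} (λ _ → 0ℚ)) (sum-replicate-zero m)

sumFin-comm : ∀ {m k} (M : Fin m → Fin k → ℚ) →
              sumFin (λ i → sumFin (M i)) ≡ sumFin (λ a → sumFin (λ i → M i a))
sumFin-comm M = begin
  sumFin (λ i → sumFin (M i))         ≡⟨ sumFin²≡sum² M ⟩
  sum (λ i → sum (M i))               ≡⟨ ∑-comm M ⟩
  sum (λ a → sum (λ i → M i a))       ≡⟨ sumFin²≡sum² (flip M) ⟨
  sumFin (λ a → sumFin (λ i → M i a)) ∎
  where
  open ≡-Reasoning
  sumFin²≡sum² : ∀ {m k} (M : Fin m → Fin k → ℚ) →
                 sumFin (λ i → sumFin (M i)) ≡ sum (λ i → sum (M i))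
  sumFin²≡sum² M = trans (sumFin≡sum (λ i → sumFin (M i))) (sum-cong-≗ (sumFin≡sum ∘ M))

sumFin-mono : ∀ {m} {f g : Fin m → ℚ} → (∀ i → f i ≤ g i) → sumFin f ≤ sumFin g
sumFin-mono {zero}  f≤g = ℚ.≤-refl
sumFin-mono {suc m} f≤g = ℚ.+-mono-≤ (f≤g zero) (sumFin-mono (f≤g ∘ suc))

sumFin-mono-equality : ∀ {m} {f g : Fin m → ℚ} → (∀ i → f i ≤ g i) → sumFin g ≤ sumFin f →
                       ∀ i → f i ≡ g i
sumFin-mono-equality {zero}  _   _     ()
sumFin-mono-equality {suc m} f≤g ∑g≤∑f = λ where
    zero    → proj₁ split
    (suc i) → sumFin-mono-equality (f≤g ∘ suc) (ℚ.≤-reflexive (sym (proj₂ split))) i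
  where split = +-mono-≤-equality (f≤g zero) (sumFin-mono (f≤g ∘ suc)) ∑g≤∑f

-- load C y a is definitionally sumFin (λ i → mask (C i) a (y i)).
mask : ∀ {n} → Subset n → Fin n → ℚ → ℚ
mask S a q = if lookup S a then q else 0ℚ

sumOn : ∀ {n} → Subset n → (Fin n → ℚ) → ℚ
sumOn S f = sumFin (λ a → mask S a (f a))

module _ {n} (S : Subset n) (a : Fin n) where

  mask-∈ : ∀ {q} → a ∈ S → mask S a q ≡ q
  mask-∈ a∈S rewrite []=⇒lookup a∈S = refl

  mask-mono : ∀ {q r} → q ≤ r → mask S a q ≤ mask S a r
  mask-mono q≤r with lookup S a
  ... | true  = q≤r
  ... | false = ℚ.≤-refl

  mask-sumFin : ∀ {m} (f : Fin m → ℚ) → mask S a (sumFin f) ≡ sumFin (λ i → mask S a (f i))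
  mask-sumFin {m} f with lookup S a
  ... | true  = refl
  ... | false = sym (sumFin-zero m)

  mask-mask : ∀ (H : Subset n) q → mask S a (mask H a q) ≡ mask (H ∩ S) a q
  mask-mask H q rewrite lookup-zipWith _∧_ a H S with lookup H a | lookup S a
  ... | true  | true  = refl
  ... | true  | false = refl
  ... | false | true  = refl
  ... | false | false = refl

sumOn-const : ∀ {n} (S : Subset n) q → sumOn S (λ _ → q) ≡ q * ℕtoℚ ∣ S ∣
sumOn-const []            q = sym (ℚ.*-zeroʳ q)
sumOn-const (outside ∷ S) q = trans (ℚ.+-identityˡ _) (sumOn-const S q)
sumOn-const (inside ∷ S)  q = begin
  q + sumOn S (λ _ → q)     ≡⟨ cong (q +_) (sumOn-const S q) ⟩
  q + q * ℕtoℚ ∣ S ∣        ≡⟨ cong (_+ q * ℕtoℚ ∣ S ∣) (ℚ.*-identityʳ q) ⟨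
  q * 1ℚ + q * ℕtoℚ ∣ S ∣   ≡⟨ ℚ.*-distribˡ-+ q 1ℚ _ ⟨
  q * (1ℚ + ℕtoℚ ∣ S ∣)     ≡⟨ cong (q *_) (ℕtoℚ-suc ∣ S ∣) ⟨
  q * ℕtoℚ (suc ∣ S ∣)      ∎
  where open ≡-Reasoning

sumOn-one : ∀ {n} (S : Subset n) → sumOn S (λ _ → 1ℚ) ≡ ℕtoℚ ∣ S ∣
sumOn-one S = trans (sumOn-const S 1ℚ) (ℚ.*-identityˡ _)

sumOn-load : ∀ {n m} (C : Family n m) (y : Fin m → ℚ) (B : Subset n) →
             sumOn B (load C y) ≡ sumFin (λ i → y i * ℕtoℚ ∣ C i ∩ B ∣)
sumOn-load C y B = begin
  sumFin (λ a → mask B a (sumFin (λ i → mask (C i) a (y i))))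
    ≡⟨ sumFin-cong (λ a → mask-sumFin B a (λ i → mask (C i) a (y i))) ⟩
  sumFin (λ a → sumFin (λ i → mask B a (mask (C i) a (y i))))
    ≡⟨ sumFin-comm (λ i a → mask B a (mask (C i) a (y i))) ⟨
  sumFin (λ i → sumFin (λ a → mask B a (mask (C i) a (y i))))
    ≡⟨ sumFin-cong (λ i → sumFin-cong (λ a → mask-mask B a (C i) (y i))) ⟩
  sumFin (λ i → sumOn (C i ∩ B) (λ _ → y i))
    ≡⟨ sumFin-cong (λ i → sumOn-const (C i ∩ B) (y i)) ⟩
  sumFin (λ i → y i * ℕtoℚ ∣ C i ∩ B ∣)
    ∎
  where open ≡-Reasoning

meets⇒1≤∣∩∣ : ∀ {n} {B H : Subset n} → Meets B H → 1 ℕ.≤ ∣ H ∩ B ∣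
meets⇒1≤∣∩∣ {B = B} {H} (a , a∈B , a∈H) =
  subst (ℕ._≤ ∣ H ∩ B ∣) (∣⁅x⁆∣≡1 a) (p⊆q⇒∣p∣≤∣q∣ ⁅a⁆⊆H∩B)
  where
  ⁅a⁆⊆H∩B : ⁅ a ⁆ ⊆ H ∩ B
  ⁅a⁆⊆H∩B x∈⁅a⁆ rewrite x∈⁅y⁆⇒x≡y a x∈⁅a⁆ = x∈p∩q⁺ (a∈H , a∈B)

module WeakDuality {n m} (C : Family n m) {y : Fin m → ℚ}
  (y≥0 : ∀ i → 0ℚ ≤ y i) (load≤1 : ∀ a → load C y a ≤ 1ℚ)
  (B : Subset n) (B-meets-support : ∀ i → y i ≢ 0ℚ → Meets B (C i)) where

  open ℚ.≤-Reasoning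

  y≤y*∣C∩B∣ : ∀ i → y i ≤ y i * ℕtoℚ ∣ C i ∩ B ∣
  y≤y*∣C∩B∣ i with y i ℚ.≟ 0ℚ
  ... | yes yᵢ≡0 rewrite yᵢ≡0 = ℚ.≤-reflexive (sym (ℚ.*-zeroˡ (ℕtoℚ ∣ C i ∩ B ∣)))
  ... | no  yᵢ≢0 = begin
    y i                        ≡⟨ ℚ.*-identityʳ (y i) ⟨
    y i * 1ℚ                   ≤⟨ ℚ.*-monoˡ-≤-nonNeg (y i) {{nonNegative (y≥0 i)}}
                                    (ℕtoℚ-mono-≤ (meets⇒1≤∣∩∣ (B-meets-support i yᵢ≢0))) ⟩
    y i * ℕtoℚ ∣ C i ∩ B ∣     ∎

  value≤sumOn-load : value y ≤ sumOn B (load C y)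
  value≤sumOn-load = ℚ.≤-trans (sumFin-mono y≤y*∣C∩B∣) (ℚ.≤-reflexive (sym (sumOn-load C y B)))

  sumOn-load≤∣B∣ : sumOn B (load C y) ≤ ℕtoℚ ∣ B ∣
  sumOn-load≤∣B∣ = ℚ.≤-trans (sumFin-mono (λ a → mask-mono B a (load≤1 a))) (ℚ.≤-reflexive (sumOn-one B))

  value≤∣B∣ : value y ≤ ℕtoℚ ∣ B ∣
  value≤∣B∣ = ℚ.≤-trans value≤sumOn-load sumOn-load≤∣B∣

  module Tight (∣B∣≤value : ℕtoℚ ∣ B ∣ ≤ value y) where

    y≡y*∣C∩B∣ : ∀ i → y i ≡ y i * ℕtoℚ ∣ C i ∩ B ∣
    y≡y*∣C∩B∣ = sumFin-mono-equality y≤y*∣C∩B∣ (begin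
      sumFin (λ i → y i * ℕtoℚ ∣ C i ∩ B ∣) ≡⟨ sumOn-load C y B ⟨
      sumOn B (load C y)                    ≤⟨ sumOn-load≤∣B∣ ⟩
      ℕtoℚ ∣ B ∣                            ≤⟨ ∣B∣≤value ⟩
      value y                               ∎)

    load≡1 : ∀ {a} → a ∈ B → load C y a ≡ 1ℚ
    load≡1 {a} a∈B = begin-equality
      load C y a             ≡⟨ mask-∈ B a a∈B ⟨
      mask B a (load C y a)  ≡⟨ saturated a ⟩
      mask B a 1ℚ            ≡⟨ mask-∈ B a a∈B ⟩
      1ℚ                     ∎
      where
      saturated : ∀ a → mask B a (load C y a) ≡ mask B a 1ℚ
      saturated = sumFin-mono-equality (λ a → mask-mono B a (load≤1 a)) (begin
        sumOn B (λ _ → 1ℚ)  ≡⟨ sumOn-one B ⟩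
        ℕtoℚ ∣ B ∣          ≤⟨ ∣B∣≤value ⟩
        value y             ≤⟨ value≤sumOn-load ⟩
        sumOn B (load C y)  ∎)

p⊆q⇒∣q∣≤∣p∣⇒q⊆p : ∀ {n} {p q : Subset n} → p ⊆ q → ∣ q ∣ ℕ.≤ ∣ p ∣ → q ⊆ p
p⊆q⇒∣q∣≤∣p∣⇒q⊆p {p = []}          {[]}          _   _   ()
p⊆q⇒∣q∣≤∣p∣⇒q⊆p {p = outside ∷ p} {outside ∷ q} p⊆q q≤p =
  out⊆ (p⊆q⇒∣q∣≤∣p∣⇒q⊆p (drop-∷-⊆ p⊆q) q≤p)
p⊆q⇒∣q∣≤∣p∣⇒q⊆p {p = outside ∷ p} {inside  ∷ q} p⊆q q≤p =
  ⊥-elim (ℕ.<-irrefl refl (ℕ.<-≤-trans q≤p (p⊆q⇒∣p∣≤∣q∣ (drop-∷-⊆ p⊆q))))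
p⊆q⇒∣q∣≤∣p∣⇒q⊆p {p = inside  ∷ p} {outside ∷ q} p⊆q q≤p with p⊆q here
... | ()
p⊆q⇒∣q∣≤∣p∣⇒q⊆p {p = inside  ∷ p} {inside  ∷ q} p⊆q q≤p =
  in⊆in (p⊆q⇒∣q∣≤∣p∣⇒q⊆p (drop-∷-⊆ p⊆q) (ℕ.s≤s⁻¹ q≤p))

module _ {n m} {S : Fin m → Set} {C : Family n m} {B : Subset n}
  (B-cover : IsCover S C B) (B-minimum : ∀ B′ → IsCover S C B′ → ∣ B ∣ ℕ.≤ ∣ B′ ∣) where

  minimumCover⇒transversal : IsTransversal S C B
  minimumCover⇒transversal =
    B-cover , λ B′ B′⊆B B′-cover → p⊆q⇒∣q∣≤∣p∣⇒q⊆p B′⊆B (B-minimum B′ B′-cover)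

  minimumCover⇒IsBn : IsBn S C ∣ B ∣
  minimumCover⇒IsBn =
    (B , minimumCover⇒transversal , refl) , λ B′ B′-transversal → B-minimum B′ (proj₁ B′-transversal)

IsPacking-mono : ∀ {n m} {S T : Fin m → Set} {C : Family n m} {y : Fin m → ℚ} →
                 (∀ i → S i → T i) → IsPacking S C y → IsPacking T C y
IsPacking-mono S⊆T (y≥0 , y-off-S , load≤1) = y≥0 , (λ i ¬Tᵢ → y-off-S i (¬Tᵢ ∘ S⊆T i)) , load≤1

module MaxPackings {n m} (C : Family n m) (covered : IsMinTransversalCovered C)
  {k : ℕ} (bn : IsBn All C k)
  {y₀ : Fin m → ℚ} (y₀-max : IsMaxPacking All C y₀) (y₀-value : value y₀ ≡ ℕtoℚ k) where

  private
    B₀ = proj₁ (proj₁ bn)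
    B₀-transversal = proj₁ (proj₂ (proj₁ bn))
    ∣B₀∣≡k = proj₂ (proj₂ (proj₁ bn))
    k≤transversal = proj₂ bn

  minTransversal-size : ∀ {B} → IsMinTransversal All C B → ∣ B ∣ ≡ k
  minTransversal-size {B} (B-transversal , B-minimum) =
    ℕ.≤-antisym (subst (∣ B ∣ ℕ.≤_) ∣B₀∣≡k (B-minimum B₀ B₀-transversal))
                (k≤transversal B B-transversal)

  maxPacking-value : ∀ {y} → IsMaxPacking All C y → value y ≡ ℕtoℚ k
  maxPacking-value (y-packing , y-max) =
    trans (ℚ.≤-antisym (proj₂ y₀-max _ y-packing) (y-max y₀ (proj₁ y₀-max))) y₀-value

  module MaxPacking {y} (y-max : IsMaxPacking All C y) where

    private
      y≥0 = proj₁ (proj₁ y-max)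
      load≤1 = proj₂ (proj₂ (proj₁ y-max))

      module AtMinTransversal {B} (B-min : IsMinTransversal All C B) =
        WeakDuality.Tight C y≥0 load≤1 B (λ i _ → proj₁ (proj₁ B-min) i tt)
          (ℚ.≤-reflexive (trans (cong ℕtoℚ (minTransversal-size B-min))
                                (sym (maxPacking-value y-max))))

    load≡1 : ∀ a → load C y a ≡ 1ℚ
    load≡1 a = AtMinTransversal.load≡1 (proj₁ (proj₂ (covered a))) (proj₂ (proj₂ (covered a)))

    support⊆tilde : ∀ i → y i ≢ 0ℚ → InTilde C i
    support⊆tilde i yᵢ≢0 B B-min =
      p≡p*c⇒c≡1 (y≥0 i) yᵢ≢0 (AtMinTransversal.y≡y*∣C∩B∣ B-min i)

    vanishes-off-tilde : ∀ i → ¬ InTilde C i → y i ≡ 0ℚ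
    vanishes-off-tilde i ¬tilde = decidable-stable (y i ℚ.≟ 0ℚ) (¬tilde ∘ support⊆tilde i)

    isPacking-tilde : IsPacking (InTilde C) C y
    isPacking-tilde = y≥0 , vanishes-off-tilde , load≤1

    k≤tildeCover : ∀ B → IsCover (InTilde C) C B → k ℕ.≤ ∣ B ∣
    k≤tildeCover B B-cover = ℕtoℚ-cancel-≤ (subst (_≤ ℕtoℚ ∣ B ∣) (maxPacking-value y-max)
      (WeakDuality.value≤∣B∣ C y≥0 load≤1 B (λ i yᵢ≢0 → B-cover i (support⊆tilde i yᵢ≢0))))

    bn-tilde : IsBn (InTilde C) C k
    bn-tilde = subst (IsBn (InTilde C) C) ∣B₀∣≡k
      (minimumCover⇒IsBn (λ i _ → proj₁ B₀-transversal i tt)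
                         (λ B B-cover → subst (ℕ._≤ ∣ B ∣) (sym ∣B₀∣≡k) (k≤tildeCover B B-cover)))

  maxPacking⇔maxPacking-tilde : ∀ y → IsMaxPacking All C y ⇔ IsMaxPacking (InTilde C) C y
  maxPacking⇔maxPacking-tilde y = mk⇔
    (λ y-max → MaxPacking.isPacking-tilde y-max ,
               λ y′ y′-packing → proj₂ y-max y′ (weaken y′-packing))
    (λ y-maxᵗ → weaken (proj₁ y-maxᵗ) ,
                λ y′ y′-packing → ℚ.≤-trans (proj₂ y₀-max y′ y′-packing)
                                            (proj₂ y-maxᵗ y₀ (MaxPacking.isPacking-tilde y₀-max)))
    where
    weaken : ∀ {y} → IsPacking (InTilde C) C y → IsPacking All C y
    weaken = IsPacking-mono {C = C} (λ _ _ → tt)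

lemma3p4 : (n m : ℕ) (C : Family n m) → IsClutter C →
    IsMinTransversalCovered C → IntegralBlocking C →
    ((y : Fin m → ℚ) → IsMaxPacking All C y →
      ((i : Fin m) → ¬ InTilde C i → y i ≡ 0ℚ) ×
      ((a : Fin n) → load C y a ≡ 1ℚ) ×
      (∃[ k ] (IsBn (InTilde C) C k × IsBn All C k × value y ≡ ℕtoℚ k)))
    × ((y : Fin m → ℚ) → IsMaxPacking All C y ⇔ IsMaxPacking (InTilde C) C y)
lemma3p4 n m C _ covered (k , bn , y₀ , y₀-max , y₀-value) =
    (λ y y-max → let open MaxPacking y-max in
      vanishes-off-tilde , load≡1 , k , bn-tilde , bn , maxPacking-value y-max)
  , maxPacking⇔maxPacking-tilde
  where open MaxPackings C covered bn y₀-max y₀-value
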